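{- Let $q$ be a prime power, let $n$ and $m\ge3$ be positive integers, and let $I,J,I_0,J_0$ be nonnegative integers with $J+J_0<n$, $I<J$ and $I_0<J_0$. Let $\mathbf{A}=(\alpha_1,\dots,\alpha_m)$ and $\overline{\mathbf{A}}=(\overline{\alpha_1},\dots,\overline{\alpha_m})$ with all entries in $\mathbb{F}_{q^n}^*$. If $(I,J)\ne(I_0,J_0)$, then $U^{I,J}_{\mathbf{A}}$ and $U^{I_0,J_0}_{\overline{\mathbf{A}}}$ are not $\Gamma\mathrm{L}(2m,q^n)$-equivalent.
   Context: For nonnegative integers $I<J<n$ and $\mathbf{A}=(\alpha_1,\dots,\alpha_m)\in(\mathbb{F}_{q^n}^*)^m$, $U^{I,J}_{\mathbf{A}}:=\{(x_1,\dots,x_m,f_1(\underline{x}),\dots,f_m(\underline{x})): x_1,\dots,x_m\in\mathbb{F}_{q^n}\}\subseteq\mathbb{F}_{q^n}^{2m}$, where $f_i(\underline{x})=x_i^{q^I}+\alpha_{i+1}x_{i+1}^{q^J}$ for $i=1,\dots,m-1$ and $f_m(\underline{x})=x_m^{q^I}+\alpha_1x_1^{q^J}$. Two $\mathbb{F}_q$-subspaces $U,U'\subseteq\mathbb{F}_{q^n}^{2m}$ are $\Gamma\mathrm{L}(2m,q^n)$-equivalent if there exist $M\in\mathrm{GL}(2m,q^n)$ and a field automorphism $\sigma$ of $\mathbb{F}_{q^n}$ such that $U'=\{M v^\sigma : v\in U\}$, where $\sigma$ acts entrywise on column vectors. -}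

module Defs where

open import Level using (Level; _⊔_) renaming (suc to lsuc)
open import Data.Nat as ℕ using (ℕ; zero; suc; _≤_; _<_)
open import Data.Nat.Primality using (Prime)
open import Data.Fin using (Fin; zero; suc; toℕ; lower₁)
open import Data.Product using (Σ; ∃; _×_; _,_)
open import Data.Vec.Functional using (Vector; _++_)
open import Relation.Binary.PropositionalEquality using (_≡_)
open import Relation.Nullary using (¬_; yes; no)
open import Algebra.Bundles using (CommutativeRing)

IsPrimePower : ℕ → Set
IsPrimePower q = Σ ℕ λ p → Σ ℕ λ k → Prime p × 1 ≤ k × q ≡ p ℕ.^ k

record Field (c ℓ : Level) : Set (lsuc (c ⊔ ℓ)) where
  field
    commutativeRing : CommutativeRing c ℓ
  open CommutativeRing commutativeRing public
  field
    1≉0      : ¬ (1# ≈ 0#)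
    inverse  : ∀ x → ¬ (x ≈ 0#) → Σ Carrier λ y → x * y ≈ 1#

module _ {c ℓ : Level} (K : Field c ℓ) where
  open Field K using (Carrier; _≈_; _+_; _*_; 0#; 1#)

  HasCardinality : ℕ → Set (c ⊔ ℓ)
  HasCardinality N =
    Σ (Fin N → Carrier) λ e →
      (∀ i j → e i ≈ e j → i ≡ j) × (∀ x → Σ (Fin N) λ i → e i ≈ x)

  pow : Carrier → ℕ → Carrier
  pow x zero    = 1#
  pow x (suc k) = x * pow x k

  record Automorphism : Set (c ⊔ ℓ) where
    field
      σ          : Carrier → Carrier
      σ-cong     : ∀ {x y} → x ≈ y → σ x ≈ σ y
      σ-+        : ∀ x y → σ (x + y) ≈ σ x + σ y
      σ-*        : ∀ x y → σ (x * y) ≈ σ x * σ y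
      σ-1        : σ 1# ≈ 1#
      σ-injective  : ∀ x y → σ x ≈ σ y → x ≈ y
      σ-surjective : ∀ y → Σ Carrier λ x → σ x ≈ y

  sumK : ∀ {d} → (Fin d → Carrier) → Carrier
  sumK {zero}  f = 0#
  sumK {suc d} f = f zero + sumK (λ i → f (suc i))

  Matrix : ℕ → Set c
  Matrix d = Fin d → Fin d → Carrier

  _·_ : ∀ {d} → Matrix d → (Fin d → Carrier) → (Fin d → Carrier)
  (M · v) i = sumK (λ j → M i j * v j)

  _⊗_ : ∀ {d} → Matrix d → Matrix d → Matrix d
  (M ⊗ N) i k = sumK (λ j → M i j * N j k)

  identity : ∀ {d} → Matrix d
  identity i j with toℕ i ℕ.≟ toℕ j
  ... | yes _ = 1#
  ... | no  _ = 0#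

  Invertible : ∀ {d} → Matrix d → Set (c ⊔ ℓ)
  Invertible {d} M = Σ (Matrix d) λ N →
    (∀ i j → (M ⊗ N) i j ≈ identity i j) × (∀ i j → (N ⊗ M) i j ≈ identity i j)

  Subset : ℕ → Set (lsuc (c ⊔ ℓ))
  Subset d = (Fin d → Carrier) → Set (c ⊔ ℓ)

  ImageIs : ∀ {d} → Matrix d → Automorphism → Subset d → Subset d → Set (c ⊔ ℓ)
  ImageIs M φ U U' =
    (∀ v → U v → U' (M · (λ i → σ (v i))))
    × (∀ w → U' w → Σ (_ → Carrier) λ v → U v × (∀ i → w i ≈ (M · (λ k → σ (v k))) i))
    where open Automorphism φ

  ΓL-Equivalent : ∀ {d} → Subset d → Subset d → Set (c ⊔ ℓ)
  ΓL-Equivalent {d} U U' =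
    Σ (Matrix d) λ M → Σ Automorphism λ φ → Invertible M × ImageIs M φ U U'

-- cyclic successor on Fin m: i ↦ i+1 for i < m-1, and m-1 ↦ 0
csuc : ∀ {m} → Fin m → Fin m
csuc {suc k} i with k ℕ.≟ toℕ i
... | yes _  = zero
... | no ne  = suc (lower₁ i ne)

module _ {c ℓ : Level} (K : Field c ℓ) where
  open Field K using (Carrier; _≈_; _+_; _*_; 0#; 1#)

  -- U^{I,J}_A = { (x_1..x_m, f_1(x)..f_m(x)) } ⊆ K^{2m}, with
  -- f_i(x) = x_i^{q^I} + α_{i+1} x_{i+1}^{q^J} (indices cyclic mod m)
  U : (q m I J : ℕ) → (Fin m → Carrier) → Subset K (m ℕ.+ m)
  U q m I J α w = Σ (Fin m → Carrier) λ x →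
    ∀ k → w k ≈ (x ++ (λ i → pow K (x i) (q ℕ.^ I)
                            + α (csuc i) * pow K (x (csuc i)) (q ℕ.^ J))) k

{-# OPTIONS --safe #-}
module Submission where

-- Only the inclusion M σ(U^{I,J}_A) ⊆ U^{I₀,J₀}_Ā is needed. As σ is onto, M (z , f(z)) lies in
-- U^{I₀,J₀}_Ā for all z, where f is built from σ(A). For z = x e_j every coordinate of M (z , f(z))
-- is a q-polynomial in x with exponents q^0, q^I, q^J, and membership in U^{I₀,J₀}_Ā says that the
-- second half equals y_i^(q^I₀) + ᾱ_{i+1} y_{i+1}^(q^J₀) for the first half y. Since x ↦ x^q is
-- additive, the right side is again a q-polynomial, and all exponents are below q^(J+J₀+1) ≤ q^n = |K|,
-- so coefficients can be compared. The top exponent q^(J+J₀) kills the upper right block of M; then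
-- M invertible gives nonzero entries in both diagonal blocks, and comparing exponents shows
-- {0, I, J} = {0, I₀, J₀}, whence (I, J) = (I₀, J₀).

open import Defs
open import Level using (Level)
import Data.Nat.Base as ℕ
open import Data.Fin using (Fin)
open import Relation.Binary.PropositionalEquality using (_≡_)
open import Relation.Nullary using (¬_)

module Primes where

  open import Data.Nat.Base using (zero; suc; _*_; _∸_; _≤_; _<_; _!; nonTrivial⇒≢1; nonTrivial⇒n>1)
  open import Data.Nat.Properties
  open import Data.Nat.Divisibility
  open import Data.Nat.Combinatorics using (_C_; k![n∸k]!∣n!)
  open import Data.Nat.Combinatorics.Specification using (nCk≡n!/k![n-k]!)
  open import Data.Nat.DivMod using (m/n*n≡m)
  open import Data.Nat.Primality
  open import Data.Product using (_,_)
  open import Data.Sum using (inj₁; inj₂)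
  open import Relation.Binary.PropositionalEquality using (_≡_; refl; subst; sym; trans; cong)
  open import Relation.Nullary using (¬_; contradiction)

  prime∤! : ∀ {p} → Prime p → ∀ k → k < p → ¬ p ∣ k !
  prime∤! pp zero    _   p∣1 = nonTrivial⇒≢1 {{prime⇒nonTrivial pp}} (∣1⇒≡1 p∣1)
  prime∤! pp (suc k) k<p p∣k! with euclidsLemma (suc k) (k !) pp p∣k!
  ... | inj₁ p∣1+k = <⇒≱ k<p (∣⇒≤ p∣1+k)
  ... | inj₂ p∣k!  = prime∤! pp k (<-trans (n<1+n k) k<p) p∣k!

  C*!*!≡! : ∀ n k → k ≤ n → (n C k) * (k ! * (n ∸ k) !) ≡ n !
  C*!*!≡! n k k≤n = trans (cong (_* d) (nCk≡n!/k![n-k]! k≤n)) (m/n*n≡m {{k !* (n ∸ k) !≢0}} (k![n∸k]!∣n! k≤n))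
    where d = k ! * (n ∸ k) !

  prime∣C : ∀ {p k} → Prime p → 0 < k → k < p → p ∣ p C k
  prime∣C {p@(suc r)} {k} pp 0<k k<p
    with euclidsLemma (p C k) (k ! * (p ∸ k) !) pp (subst (p ∣_) (sym (C*!*!≡! p k (<⇒≤ k<p))) (m∣m*n (r !)))
  ... | inj₁ p∣C = p∣C
  ... | inj₂ p∣!! with euclidsLemma (k !) ((p ∸ k) !) pp p∣!!
  ...   | inj₁ p∣k!   = contradiction p∣k! (prime∤! pp k k<p)
  ...   | inj₂ p∣p-k! = contradiction p∣p-k! (prime∤! pp (p ∸ k) (∸-monoʳ-< 0<k (<⇒≤ k<p)))

  prime-power>1 : ∀ {q} → IsPrimePower q → 1 < q
  prime-power>1 (p , k , pp , 0<k , refl) = ^-monoʳ-< p (nonTrivial⇒n>1 p {{prime⇒nonTrivial pp}}) 0<k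

module IncreasingPairs where

  open import Data.Nat.Base using (_≤_; _<_; z≤n)
  open import Data.Nat.Properties using (≤-refl; ≤-antisym; <⇒≤; <-irrefl)
  open import Data.List.Base using ([]; _∷_)
  open import Data.List.Membership.Propositional using (_∈_)
  open import Data.List.Relation.Unary.Any using (here; there)
  open import Data.Product using (_,_)
  open import Data.Sum using (_⊎_; inj₁; inj₂)
  open import Relation.Binary.PropositionalEquality using (_≡_; refl; sym; trans; subst; cong₂)
  open import Relation.Nullary using (contradiction)

  ∈-0∷a∷b⇒≤b : ∀ {x a b} → a ≤ b → x ∈ 0 ∷ a ∷ b ∷ [] → x ≤ b
  ∈-0∷a∷b⇒≤b _   (here refl)                 = z≤n
  ∈-0∷a∷b⇒≤b a≤b (there (here refl))         = a≤b
  ∈-0∷a∷b⇒≤b _   (there (there (here refl))) = ≤-refl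

  ∈-0∷a∷b∧<b⇒0⊎a : ∀ {x a b} → x < b → x ∈ 0 ∷ a ∷ b ∷ [] → x ≡ 0 ⊎ x ≡ a
  ∈-0∷a∷b∧<b⇒0⊎a _   (here refl)                 = inj₁ refl
  ∈-0∷a∷b∧<b⇒0⊎a _   (there (here refl))         = inj₂ refl
  ∈-0∷a∷b∧<b⇒0⊎a x<b (there (there (here refl))) = contradiction x<b (<-irrefl refl)

  0∷I∷J-injective : ∀ {I J I₀ J₀} → I < J → I₀ < J₀ →
    I ∈ 0 ∷ I₀ ∷ J₀ ∷ [] → J ∈ 0 ∷ I₀ ∷ J₀ ∷ [] →
    I₀ ∈ 0 ∷ I ∷ J ∷ [] → J₀ ∈ 0 ∷ I ∷ J ∷ [] → (I , J) ≡ (I₀ , J₀)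
  0∷I∷J-injective {I} {J} {I₀} {J₀} I<J I₀<J₀ I∈ J∈ I₀∈ J₀∈ = cong₂ _,_ I≡I₀ J≡J₀
    where
    J≡J₀ : J ≡ J₀
    J≡J₀ = ≤-antisym (∈-0∷a∷b⇒≤b (<⇒≤ I₀<J₀) J∈) (∈-0∷a∷b⇒≤b (<⇒≤ I<J) J₀∈)
    I≡I₀ : I ≡ I₀
    I≡I₀ with ∈-0∷a∷b∧<b⇒0⊎a (subst (I <_) J≡J₀ I<J) I∈
            | ∈-0∷a∷b∧<b⇒0⊎a (subst (I₀ <_) (sym J≡J₀) I₀<J₀) I₀∈
    ... | inj₂ I≡I₀ | _          = I≡I₀
    ... | inj₁ _    | inj₂ I₀≡I  = sym I₀≡I
    ... | inj₁ I≡0  | inj₁ I₀≡0  = trans I≡0 (sym I₀≡0)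

module FieldProperties {c ℓ} (K : Field c ℓ) where

  open import Data.Nat.Base using (zero; suc; NonZero)
  import Data.Nat.Properties as ℕ
  open import Data.Fin.Base using (Fin; zero; suc; toℕ; punchIn; _↑ˡ_; _↑ʳ_)
  open import Data.Fin.Properties using (punchInᵢ≢i)
  open import Data.Product using (_,_)
  open import Function using (_∘_)
  open import Relation.Binary.PropositionalEquality as ≡ using (_≡_; _≢_)
  open import Relation.Nullary using (¬_; yes; no; contradiction)

  open Field K hiding (zero)
  open import Relation.Binary.Reasoning.Setoid setoid
  open import Algebra.Properties.Semiring.Exp semiring public
    using (_^_; ^-congˡ; ^-assocʳ)
  open import Algebra.Properties.CommutativeSemiring.Exp commutativeSemiring public
    using (^-distrib-*)
  open import Algebra.Properties.Semiring.Sum semiring public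
    using (sum; sum-cong-≋; ∑-distrib-+; sum-remove; sum-replicate-zero; sum-permute)
  open import Algebra.Properties.Group +-group using (x∙y⁻¹≈ε⇒x≈y; x≈y⇒x∙y⁻¹≈ε)
  open import Algebra.Properties.Ring ring using ([y-z]x≈yx-zx)

  pow≡^ : ∀ x k → pow K x k ≡ x ^ k
  pow≡^ x zero    = ≡.refl
  pow≡^ x (suc k) = ≡.cong (x *_) (pow≡^ x k)

  x*y≈0⇒y≈0 : ∀ {x y} → ¬ x ≈ 0# → x * y ≈ 0# → y ≈ 0#
  x*y≈0⇒y≈0 {x} {y} x≉0 xy≈0 with inverse x x≉0
  ... | x⁻¹ , xx⁻¹≈1 = begin
    y              ≈⟨ *-identityˡ y ⟨
    1# * y         ≈⟨ *-congʳ (trans (*-comm x⁻¹ x) xx⁻¹≈1) ⟨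
    (x⁻¹ * x) * y  ≈⟨ *-assoc x⁻¹ x y ⟩
    x⁻¹ * (x * y)  ≈⟨ *-congˡ xy≈0 ⟩
    x⁻¹ * 0#       ≈⟨ zeroʳ x⁻¹ ⟩
    0#             ∎

  *-≉0 : ∀ {x y} → ¬ x ≈ 0# → ¬ y ≈ 0# → ¬ x * y ≈ 0#
  *-≉0 x≉0 y≉0 xy≈0 = y≉0 (x*y≈0⇒y≈0 x≉0 xy≈0)

  ^-≉0 : ∀ {x} k → ¬ x ≈ 0# → ¬ x ^ k ≈ 0#
  ^-≉0 zero    _   = 1≉0
  ^-≉0 (suc k) x≉0 = *-≉0 x≉0 (^-≉0 k x≉0)

  x*z≈y*z⇒z≈0 : ∀ {x y z} → ¬ x ≈ y → x * z ≈ y * z → z ≈ 0#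
  x*z≈y*z⇒z≈0 {x} {y} {z} x≉y xz≈yz = x*y≈0⇒y≈0 (x≉y ∘ x∙y⁻¹≈ε⇒x≈y x y) (begin
    (x - y) * z     ≈⟨ [y-z]x≈yx-zx z x y ⟩
    x * z - y * z   ≈⟨ x≈y⇒x∙y⁻¹≈ε xz≈yz ⟩
    0#              ∎)

  0^n≈0 : ∀ n → .{{NonZero n}} → 0# ^ n ≈ 0#
  0^n≈0 (suc n) = zeroˡ (0# ^ n)

  sumK≡sum : ∀ {d} (f : Fin d → Carrier) → sumK K f ≡ sum f
  sumK≡sum {zero}  f = ≡.refl
  sumK≡sum {suc d} f = ≡.cong (f zero +_) (sumK≡sum (f ∘ suc))

  sum-≈0 : ∀ {d} {f : Fin d → Carrier} → (∀ k → f k ≈ 0#) → sum f ≈ 0#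
  sum-≈0 {d} f≈0 = trans (sum-cong-≋ f≈0) (sum-replicate-zero d)

  sum-single : ∀ {d} (f : Fin d → Carrier) j → (∀ k → k ≢ j → f k ≈ 0#) → sum f ≈ f j
  sum-single {suc d} f j f≈0 = begin
    sum f                          ≈⟨ sum-remove f ⟩
    f j + sum (f ∘ punchIn j)      ≈⟨ +-congˡ (sum-≈0 (λ k → f≈0 (punchIn j k) (punchInᵢ≢i j k))) ⟩
    f j + 0#                       ≈⟨ +-identityʳ (f j) ⟩
    f j                            ∎

  sum-↑ : ∀ m {n} (f : Fin (m ℕ.+ n) → Carrier) → sum f ≈ sum (f ∘ (_↑ˡ n)) + sum (f ∘ (m ↑ʳ_))
  sum-↑ zero    f = sym (+-identityˡ (sum f))
  sum-↑ (suc m) f = trans (+-congˡ (sum-↑ m (f ∘ suc))) (sym (+-assoc _ _ _))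

  identity-diagonal : ∀ {d} (i : Fin d) → identity K i i ≈ 1#
  identity-diagonal i with toℕ i ℕ.≟ toℕ i
  ... | yes _ = refl
  ... | no ¬≡ = contradiction ≡.refl ¬≡

  invertible⇒column≉0 : ∀ {d} {M : Matrix K d} → Invertible K M → ∀ j → ¬ (∀ i → M i j ≈ 0#)
  invertible⇒column≉0 {d} {M} (N , _ , N⊗M≈I) j column≈0 = 1≉0 (begin
    1#                               ≈⟨ trans (N⊗M≈I j j) (identity-diagonal j) ⟨
    sumK K (λ k → N j k * M k j)     ≡⟨ sumK≡sum {d} _ ⟩
    sum (λ k → N j k * M k j)        ≈⟨ sum-≈0 (λ k → trans (*-congˡ (column≈0 k)) (zeroʳ _)) ⟩
    0#                               ∎)

  invertible⇒row≉0 : ∀ {d} {M : Matrix K d} → Invertible K M → ∀ i → ¬ (∀ j → M i j ≈ 0#)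
  invertible⇒row≉0 {d} {M} (N , M⊗N≈I , _) i row≈0 = 1≉0 (begin
    1#                               ≈⟨ trans (M⊗N≈I i i) (identity-diagonal i) ⟨
    sumK K (λ k → M i k * N k i)     ≡⟨ sumK≡sum {d} _ ⟩
    sum (λ k → M i k * N k i)        ≈⟨ sum-≈0 (λ k → trans (*-congʳ (row≈0 k)) (zeroˡ _)) ⟩
    0#                               ∎)

  ·-cong : ∀ {d} (M : Matrix K d) {v v′ : Fin d → Carrier} → (∀ k → v k ≈ v′ k) → ∀ i → _·_ K M v i ≈ _·_ K M v′ i
  ·-cong {d} M {v} {v′} v≈v′ i = begin
    sumK K (λ k → M i k * v k)    ≡⟨ sumK≡sum {d} _ ⟩
    sum (λ k → M i k * v k)       ≈⟨ sum-cong-≋ (λ k → *-congˡ (v≈v′ k)) ⟩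
    sum (λ k → M i k * v′ k)      ≡⟨ sumK≡sum {d} _ ⟨
    sumK K (λ k → M i k * v′ k)   ∎

  module AutomorphismProperties (φ : Automorphism K) where

    open Automorphism φ
    open import Algebra.Properties.Group +-group using (identityʳ-unique)

    σ-0# : σ 0# ≈ 0#
    σ-0# = identityʳ-unique (σ 0#) (σ 0#) (trans (sym (σ-+ 0# 0#)) (σ-cong (+-identityʳ 0#)))

    σ-^ : ∀ x k → σ (x ^ k) ≈ σ x ^ k
    σ-^ x zero    = σ-1
    σ-^ x (suc k) = trans (σ-* x (x ^ k)) (*-congˡ (σ-^ x k))

    σ-≉0 : ∀ {x} → ¬ x ≈ 0# → ¬ σ x ≈ 0#
    σ-≉0 {x} x≉0 σx≈0 = x≉0 (σ-injective x 0# (trans σx≈0 (sym σ-0#)))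

module FiniteField {c ℓ} (K : Field c ℓ) {N} (card : HasCardinality K N) where

  open import Data.Nat.Base using (zero; suc)
  open import Data.Fin.Base using (Fin)
  import Data.Fin.Properties as Fin
  open import Data.Fin.Permutation using (Permutation; permutation)
  open import Data.Product using (proj₁; proj₂)
  open import Relation.Binary.Definitions using (Decidable)
  open import Relation.Binary.PropositionalEquality as ≡ using (_≡_)
  open import Relation.Nullary using (yes; no; contradiction)

  open Field K hiding (zero)
  open FieldProperties K
  open import Relation.Binary.Reasoning.Setoid setoid
  open import Algebra.Properties.Semiring.Mult semiring using (_×_; ×-homo-1; ×1-homo-*)
  open import Algebra.Properties.Semiring.Sum semiring using (sum-replicate)
  open import Algebra.Properties.Group +-group using (identityʳ-unique)

  enum : Fin N → Carrier
  enum = proj₁ card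

  enum-injective : ∀ i j → enum i ≈ enum j → i ≡ j
  enum-injective = proj₁ (proj₂ card)

  index : Carrier → Fin N
  index x = proj₁ (proj₂ (proj₂ card) x)

  enum-index : ∀ x → enum (index x) ≈ x
  enum-index x = proj₂ (proj₂ (proj₂ card) x)

  _≟_ : Decidable _≈_
  x ≟ y with index x Fin.≟ index y
  ... | yes i≡j = yes (trans (sym (enum-index x)) (trans (reflexive (≡.cong enum i≡j)) (enum-index y)))
  ... | no  i≢j = no λ x≈y → i≢j (enum-injective _ _ (trans (enum-index x) (trans x≈y (sym (enum-index y)))))

  -- Translation by 1# permutes K, so ∑ x ≈ ∑ (x + 1#) ≈ ∑ x + N × 1#.
  N×1≈0 : N × 1# ≈ 0#
  N×1≈0 = identityʳ-unique (sum enum) (N × 1#) (begin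
    sum enum + N × 1#                      ≈⟨ +-congˡ (sum-replicate N) ⟨
    sum enum + sum {N} (λ _ → 1#)          ≈⟨ ∑-distrib-+ enum (λ _ → 1#) ⟨
    sum (λ i → enum i + 1#)                ≈⟨ sum-cong-≋ (λ i → enum-index (enum i + 1#)) ⟨
    sum (λ i → enum (shift i))             ≈⟨ sum-permute enum translation ⟨
    sum enum                               ∎)
    where
    shift unshift : Fin N → Fin N
    shift   i = index (enum i + 1#)
    unshift i = index (enum i - 1#)
    translation : Permutation N N
    translation = permutation shift unshift
      (λ i → enum-injective _ _ (begin
        enum (shift (unshift i))  ≈⟨ trans (enum-index _) (+-congʳ (enum-index _)) ⟩
        (enum i - 1#) + 1#        ≈⟨ +-assoc _ _ _ ⟩
        enum i + (- 1# + 1#)      ≈⟨ +-congˡ (-‿inverseˡ 1#) ⟩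
        enum i + 0#               ≈⟨ +-identityʳ _ ⟩
        enum i                    ∎))
      (λ i → enum-injective _ _ (begin
        enum (unshift (shift i))  ≈⟨ trans (enum-index _) (+-congʳ (enum-index _)) ⟩
        (enum i + 1#) - 1#        ≈⟨ +-assoc _ _ _ ⟩
        enum i + (1# - 1#)        ≈⟨ +-congˡ (-‿inverseʳ 1#) ⟩
        enum i + 0#               ≈⟨ +-identityʳ _ ⟩
        enum i                    ∎))

  ^≈0⇒≈0 : ∀ {x} k → x ^ k ≈ 0# → x ≈ 0#
  ^≈0⇒≈0 {x} k x^k≈0 with x ≟ 0#
  ... | yes x≈0 = x≈0
  ... | no  x≉0 = contradiction x^k≈0 (^-≉0 k x≉0)

  p^t×1≈[p×1]^t : ∀ p t → (p ℕ.^ t) × 1# ≈ (p × 1#) ^ t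
  p^t×1≈[p×1]^t p zero    = ×-homo-1 1#
  p^t×1≈[p×1]^t p (suc t) = trans (×1-homo-* p (p ℕ.^ t)) (*-congˡ (p^t×1≈[p×1]^t p t))

  characteristic : ∀ {p t} → N ≡ p ℕ.^ t → p × 1# ≈ 0#
  characteristic {p} {t} N≡p^t with (p × 1#) ≟ 0#
  ... | yes p×1≈0 = p×1≈0
  ... | no  p×1≉0 = contradiction (begin
    (p × 1#) ^ t      ≈⟨ p^t×1≈[p×1]^t p t ⟨
    (p ℕ.^ t) × 1#    ≡⟨ ≡.cong (_× 1#) N≡p^t ⟨
    N × 1#            ≈⟨ N×1≈0 ⟩
    0#                ∎) (^-≉0 t p×1≉0)

module Frobenius {c ℓ} (K : Field c ℓ) where

  open import Data.Nat.Base using (zero; suc; _∸_; z<s; s<s)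
  import Data.Nat.Properties as ℕ
  open import Data.Nat.Combinatorics using (_C_; nCn≡1)
  open import Data.Nat.Divisibility using (divides)
  open import Data.Nat.Primality using (Prime; prime⇒nonZero)
  open import Data.Fin.Base using (zero; suc; toℕ; fromℕ; inject₁)
  open import Data.Fin.Properties using (toℕ-fromℕ; inject₁ℕ<)
  open import Data.Vec.Functional using (last)
  open import Data.Product using (_,_)
  open import Relation.Binary.PropositionalEquality as ≡ using (_≡_)

  open Field K hiding (zero)
  open FieldProperties K
  open import Relation.Binary.Reasoning.Setoid setoid
  open import Algebra.Properties.Semiring.Mult semiring using (_×_; ×-assocˡ; ×-assoc-*; ×-congʳ)
  open import Algebra.Properties.Semiring.Sum semiring using (sum-init-last)
  import Algebra.Properties.CommutativeSemiring.Binomial commutativeSemiring as Binomial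
  open Primes using (prime∣C)

  p×1≈0⇒p×≈0 : ∀ {p} → p × 1# ≈ 0# → ∀ x → p × x ≈ 0#
  p×1≈0⇒p×≈0 {p} p×1≈0 x = begin
    p × x          ≈⟨ ×-congʳ p (*-identityˡ x) ⟨
    p × (1# * x)   ≈⟨ ×-assoc-* p 1# x ⟨
    (p × 1#) * x   ≈⟨ *-congʳ p×1≈0 ⟩
    0# * x         ≈⟨ zeroˡ x ⟩
    0#             ∎

  C×≈0 : ∀ {p k} → Prime p → p × 1# ≈ 0# → ∀ x → 0 ℕ.< k → k ℕ.< p → (p C k) × x ≈ 0#
  C×≈0 {p} {k} pp p×1≈0 x 0<k k<p with prime∣C pp 0<k k<p
  ... | divides s pCk≡s*p = begin
    (p C k) × x        ≡⟨ ≡.cong (_× x) (≡.trans pCk≡s*p (ℕ.*-comm s p)) ⟩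
    (p ℕ.* s) × x      ≈⟨ ×-assocˡ x p s ⟨
    p × (s × x)        ≈⟨ p×1≈0⇒p×≈0 {p} p×1≈0 (s × x) ⟩
    0#                 ∎

  freshman's-dream : ∀ {p} → Prime p → p × 1# ≈ 0# → ∀ x y → (x + y) ^ p ≈ x ^ p + y ^ p
  freshman's-dream {zero}  pp _ with prime⇒nonZero pp
  ... | ()
  freshman's-dream {suc r} pp p×1≈0 x y = begin
    (x + y) ^ suc r                                ≈⟨ Binomial.theorem (suc r) x y ⟩
    sum term                                       ≈⟨ sum-init-last term ⟩
    (term zero + sum (λ i → term (suc (inject₁ i)))) + last term
      ≈⟨ +-cong (+-cong (trans (+-identityʳ _) (*-identityˡ _)) (sum-≈0 middle≈0)) last≈x^p ⟩
    (y ^ suc r + 0#) + x ^ suc r                   ≈⟨ +-congʳ (+-identityʳ _) ⟩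
    y ^ suc r + x ^ suc r                          ≈⟨ +-comm _ _ ⟩
    x ^ suc r + y ^ suc r                          ∎
    where
    term = Binomial.binomialTerm x y (suc r)
    middle≈0 : ∀ i → term (suc (inject₁ i)) ≈ 0#
    middle≈0 i = C×≈0 pp p×1≈0 _ z<s (s<s (inject₁ℕ< i))
    top-term : ∀ k → k ≡ suc r → (suc r C k) × (x ^ k * y ^ (suc r ∸ k)) ≈ x ^ suc r
    top-term _ ≡.refl = begin
      (suc r C suc r) × (x ^ suc r * y ^ (r ∸ r))
        ≡⟨ ≡.cong₂ (λ a b → a × (x ^ suc r * y ^ b)) (nCn≡1 (suc r)) (ℕ.n∸n≡0 r) ⟩
      1 × (x ^ suc r * 1#)
        ≈⟨ trans (+-identityʳ _) (*-identityʳ _) ⟩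
      x ^ suc r ∎
    last≈x^p : last term ≈ x ^ suc r
    last≈x^p = top-term (suc (toℕ (fromℕ r))) (≡.cong suc (toℕ-fromℕ r))

  freshman's-dream-^ : ∀ {p} → Prime p → p × 1# ≈ 0# →
                       ∀ t x y → (x + y) ^ (p ℕ.^ t) ≈ x ^ (p ℕ.^ t) + y ^ (p ℕ.^ t)
  freshman's-dream-^ pp p×1≈0 zero    x y = trans (*-identityʳ _) (sym (+-cong (*-identityʳ x) (*-identityʳ y)))
  freshman's-dream-^ {p} pp p×1≈0 (suc t) x y = begin
    (x + y) ^ (p ℕ.* p ℕ.^ t)                 ≈⟨ ^-assocʳ (x + y) p (p ℕ.^ t) ⟨
    ((x + y) ^ p) ^ (p ℕ.^ t)                 ≈⟨ ^-congˡ (p ℕ.^ t) (freshman's-dream pp p×1≈0 x y) ⟩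
    (x ^ p + y ^ p) ^ (p ℕ.^ t)               ≈⟨ freshman's-dream-^ pp p×1≈0 t (x ^ p) (y ^ p) ⟩
    (x ^ p) ^ (p ℕ.^ t) + (y ^ p) ^ (p ℕ.^ t) ≈⟨ +-cong (^-assocʳ x p _) (^-assocʳ y p _) ⟩
    x ^ (p ℕ.* p ℕ.^ t) + y ^ (p ℕ.* p ℕ.^ t) ∎

  prime-power-additive : ∀ {q n} → IsPrimePower q → HasCardinality K (q ℕ.^ n) →
                         ∀ e x y → (x + y) ^ (q ℕ.^ e) ≈ x ^ (q ℕ.^ e) + y ^ (q ℕ.^ e)
  prime-power-additive {n = n} (p , k , pp , _ , ≡.refl) card e x y =
    ≡.subst (λ E → (x + y) ^ E ≈ x ^ E + y ^ E) (≡.sym (ℕ.^-*-assoc p k e))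
      (freshman's-dream-^ pp (characteristic {p} {k ℕ.* n} (ℕ.^-*-assoc p k n)) (k ℕ.* e) x y)
    where open FiniteField K card using (characteristic)

module Polynomial {c ℓ} (K : Field c ℓ) where

  open import Data.Nat.Base using (ℕ; zero; suc; s<s)
  open import Data.Fin.Base using (Fin; zero; suc)
  open import Data.Fin.Properties using (suc-injective)
  open import Data.Vec.Base using (Vec; []; _∷_)
  open import Data.Vec.Relation.Unary.All using (All; []; _∷_)
  open import Function using (_∘_)
  open import Relation.Binary.PropositionalEquality as ≡ using (_≡_; _≢_)
  open import Relation.Nullary using (contradiction)

  open Field K hiding (zero)
  open FieldProperties K
  open import Relation.Binary.Reasoning.Setoid setoid
  open import Algebra.Properties.CommutativeSemigroup *-commutativeSemigroup using (x∙yz≈y∙xz)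
  open import Algebra.Solver.Ring.NaturalCoefficients.Default commutativeSemiring
    using (solve; _:=_; _:+_; _:*_; con)

  -- coefficient lists start with the constant term
  eval : ∀ {D} → Vec Carrier D → Carrier → Carrier
  eval []       x = 0#
  eval (a ∷ as) x = a + x * eval as x

  quotient : ∀ {D} → Carrier → Vec Carrier (suc D) → Vec Carrier D
  quotient r (a ∷ [])         = []
  quotient r (a ∷ as@(_ ∷ _)) = eval as r ∷ quotient r as

  -- P(x) - P(r) ≈ (x - r) Q(x) for Q = quotient r P, with both sides moved so that no subtraction occurs
  division : ∀ {D} (P : Vec Carrier (suc D)) r x →
             eval P x + r * eval (quotient r P) x ≈ eval P r + x * eval (quotient r P) x
  division (a ∷ []) r x =
    solve 3 (λ a r x → (a :+ x :* con 0) :+ r :* con 0 := (a :+ r :* con 0) :+ x :* con 0) refl a r x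
  division (a ∷ as@(_ ∷ _)) r x = begin
    (a + x * A) + r * (B + x * Q)  ≈⟨ solve 6 (λ a x r A B Q → (a :+ x :* A) :+ r :* (B :+ x :* Q)
                                                           := (a :+ r :* B) :+ x :* (A :+ r :* Q)) refl a x r A B Q ⟩
    (a + r * B) + x * (A + r * Q)  ≈⟨ +-congˡ (*-congˡ (division as r x)) ⟩
    (a + r * B) + x * (B + x * Q)  ∎
    where
    A = eval as x
    B = eval as r
    Q = eval (quotient r as) x

  a+r*b≈0⇒a≈0 : ∀ {a b} r → b ≈ 0# → a + r * b ≈ 0# → a ≈ 0#
  a+r*b≈0⇒a≈0 {a} {b} r b≈0 a+rb≈0 = begin
    a            ≈⟨ +-identityʳ a ⟨
    a + 0#       ≈⟨ +-congˡ (trans (*-congˡ b≈0) (zeroʳ r)) ⟨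
    a + r * b    ≈⟨ a+rb≈0 ⟩
    0#           ∎

  quotient≈0⇒≈0 : ∀ {D} (P : Vec Carrier (suc D)) r →
                  eval P r ≈ 0# → All (_≈ 0#) (quotient r P) → All (_≈ 0#) P
  quotient≈0⇒≈0 (a ∷ [])         r P[r]≈0 []          = a+r*b≈0⇒a≈0 r refl P[r]≈0 ∷ []
  quotient≈0⇒≈0 (a ∷ as@(_ ∷ _)) r P[r]≈0 (B≈0 ∷ Q≈0) = a+r*b≈0⇒a≈0 r B≈0 P[r]≈0 ∷ quotient≈0⇒≈0 as r B≈0 Q≈0

  vanishing⇒≈0 : ∀ {D} (P : Vec Carrier D) (e : Fin D → Carrier) → (∀ i j → e i ≈ e j → i ≡ j) →
                 (∀ i → eval P (e i) ≈ 0#) → All (_≈ 0#) P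
  vanishing⇒≈0 []        e e-injective P[e]≈0 = []
  vanishing⇒≈0 P@(_ ∷ _) e e-injective P[e]≈0 =
    quotient≈0⇒≈0 P r (P[e]≈0 zero)
      (vanishing⇒≈0 (quotient r P) (e ∘ suc) (λ i j → suc-injective ∘ e-injective (suc i) (suc j)) Q[e]≈0)
    where
    r = e zero
    Q[e]≈0 : ∀ i → eval (quotient r P) (e (suc i)) ≈ 0#
    Q[e]≈0 i = x*z≈y*z⇒z≈0 (λ x≈r → suc≢0 (e-injective (suc i) zero x≈r)) (begin
      x * Q                ≈⟨ +-identityˡ _ ⟨
      0# + x * Q           ≈⟨ +-congʳ (P[e]≈0 zero) ⟨
      eval P r + x * Q     ≈⟨ division P r x ⟨
      eval P x + r * Q     ≈⟨ +-congʳ (P[e]≈0 (suc i)) ⟩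
      0# + r * Q           ≈⟨ +-identityˡ _ ⟩
      r * Q                ∎)
      where
      x = e (suc i)
      Q = eval (quotient r P) x
      suc≢0 : suc i ≢ zero
      suc≢0 ()

  dense : (D : ℕ) → (ℕ → Carrier) → Vec Carrier D
  dense zero    f = []
  dense (suc D) f = f 0 ∷ dense D (f ∘ suc)

  dense≈0⇒≈0 : ∀ {D f} → All (_≈ 0#) (dense D f) → ∀ {k} → k ℕ.< D → f k ≈ 0#
  dense≈0⇒≈0 (f0≈0 ∷ _)  {zero}  _         = f0≈0
  dense≈0⇒≈0 (_ ∷ f+≈0)  {suc k} (s<s k<D) = dense≈0⇒≈0 f+≈0 k<D

  monomial : ℕ → Carrier → ℕ → Carrier
  monomial zero    a zero    = a
  monomial zero    a (suc k) = 0#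
  monomial (suc e) a zero    = 0#
  monomial (suc e) a (suc k) = monomial e a k

  monomial-diagonal : ∀ e a → monomial e a e ≡ a
  monomial-diagonal zero    a = ≡.refl
  monomial-diagonal (suc e) a = monomial-diagonal e a

  monomial-off : ∀ {e k} a → e ≢ k → monomial e a k ≡ 0#
  monomial-off {zero}  {zero}  a e≢k = contradiction ≡.refl e≢k
  monomial-off {zero}  {suc k} a e≢k = ≡.refl
  monomial-off {suc e} {zero}  a e≢k = ≡.refl
  monomial-off {suc e} {suc k} a e≢k = monomial-off a (e≢k ∘ ≡.cong suc)

  eval-dense-0# : ∀ D x → eval (dense D (λ _ → 0#)) x ≈ 0#
  eval-dense-0# zero    x = refl
  eval-dense-0# (suc D) x = trans (+-identityˡ _) (trans (*-congˡ (eval-dense-0# D x)) (zeroʳ x))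

  eval-dense-+ : ∀ D f g x → eval (dense D (λ k → f k + g k)) x ≈ eval (dense D f) x + eval (dense D g) x
  eval-dense-+ zero    f g x = sym (+-identityˡ 0#)
  eval-dense-+ (suc D) f g x = begin
    (f 0 + g 0) + x * eval (dense D (λ k → f (suc k) + g (suc k))) x
      ≈⟨ +-congˡ (*-congˡ (eval-dense-+ D (f ∘ suc) (g ∘ suc) x)) ⟩
    (f 0 + g 0) + x * (F + G)
      ≈⟨ solve 5 (λ a b x F G → (a :+ b) :+ x :* (F :+ G) := (a :+ x :* F) :+ (b :+ x :* G)) refl (f 0) (g 0) x F G ⟩
    (f 0 + x * F) + (g 0 + x * G) ∎
    where
    F = eval (dense D (f ∘ suc)) x
    G = eval (dense D (g ∘ suc)) x

  eval-monomial : ∀ {D e} a x → e ℕ.< D → eval (dense D (monomial e a)) x ≈ a * x ^ e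
  eval-monomial {suc D} {zero}  a x _         = begin
    a + x * eval (dense D (λ _ → 0#)) x   ≈⟨ +-congˡ (trans (*-congˡ (eval-dense-0# D x)) (zeroʳ x)) ⟩
    a + 0#                                ≈⟨ +-identityʳ a ⟩
    a                                     ≈⟨ *-identityʳ a ⟨
    a * 1#                                ∎
  eval-monomial {suc D} {suc e} a x (s<s e<D) = begin
    0# + x * eval (dense D (monomial e a)) x   ≈⟨ +-identityˡ _ ⟩
    x * eval (dense D (monomial e a)) x        ≈⟨ *-congˡ (eval-monomial a x e<D) ⟩
    x * (a * x ^ e)                            ≈⟨ x∙yz≈y∙xz x a (x ^ e) ⟩
    a * (x * x ^ e)                            ∎

module Linearized {c ℓ} (K : Field c ℓ) {q} (1<q : 1 ℕ.< q) where

  open import Data.Nat.Base using (ℕ; zero; suc; NonZero; _≤_; _<_; z<s)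
  import Data.Nat.Properties as ℕ
  open import Data.List.Base using (List; []; _∷_; _++_; map)
  open import Data.List.Membership.Propositional using (_∈_)
  open import Data.List.Relation.Unary.All as All using (All; []; _∷_)
  open import Data.List.Relation.Unary.All.Properties using (++⁺; map⁺)
  open import Data.List.Relation.Unary.Any using (here; there)
  import Data.Product as Product
  open import Data.Product using (_×_; _,_; proj₂; map₁)
  open import Function using (_∘_)
  open import Relation.Binary using (tri<; tri≈; tri>)
  open import Relation.Binary.PropositionalEquality as ≡ using (_≡_; _≢_)
  open import Relation.Nullary using (¬_; yes; no; contradiction)

  open Field K hiding (zero)
  open FieldProperties K
  open import Relation.Binary.Reasoning.Setoid setoid
  open Polynomial K using (eval; dense; dense≈0⇒≈0; vanishing⇒≈0; monomial; monomial-diagonal; monomial-off;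
                           eval-dense-0#; eval-dense-+; eval-monomial)
  open import Algebra.Properties.Group +-group using (x∙y⁻¹≈ε⇒x≈y)
  open import Algebra.Properties.Ring ring using (-1*x≈-x)

  instance
    q≢0 : NonZero q
    q≢0 = ℕ.>-nonZero (ℕ.<-trans z<s 1<q)

  q^-injective : ∀ {e E} → q ℕ.^ e ≡ q ℕ.^ E → e ≡ E
  q^-injective {e} {E} q^e≡q^E with ℕ.<-cmp e E
  ... | tri< e<E _ _ = contradiction q^e≡q^E (ℕ.<⇒≢ (ℕ.^-monoʳ-< q 1<q e<E))
  ... | tri≈ _ e≡E _ = e≡E
  ... | tri> _ _ E<e = contradiction (≡.sym q^e≡q^E) (ℕ.<⇒≢ (ℕ.^-monoʳ-< q 1<q E<e))

  0^q^e≈0 : ∀ e → 0# ^ (q ℕ.^ e) ≈ 0#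
  0^q^e≈0 e = 0^n≈0 (q ℕ.^ e) {{ℕ.m^n≢0 q e}}

  -- (a , e) stands for the term a X^(q^e)
  Terms : Set c
  Terms = List (Carrier × ℕ)

  ⟦_⟧ : Terms → Carrier → Carrier
  ⟦ []           ⟧ x = 0#
  ⟦ (a , e) ∷ ts ⟧ x = a * x ^ (q ℕ.^ e) + ⟦ ts ⟧ x

  coefficient : Terms → ℕ → Carrier
  coefficient []             E = 0#
  coefficient ((a , e) ∷ ts) E = monomial e a E + coefficient ts E

  Degree≤ : ℕ → Terms → Set c
  Degree≤ d = All (λ t → proj₂ t ≤ d)

  scale : Carrier → Terms → Terms
  scale s = map (map₁ (s *_))

  frobenius : ℕ → Terms → Terms
  frobenius k = map (Product.map (_^ (q ℕ.^ k)) (ℕ._+ k))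

  ⟦++⟧ : ∀ ts us x → ⟦ ts ++ us ⟧ x ≈ ⟦ ts ⟧ x + ⟦ us ⟧ x
  ⟦++⟧ []             us x = sym (+-identityˡ _)
  ⟦++⟧ ((a , e) ∷ ts) us x = trans (+-congˡ (⟦++⟧ ts us x)) (sym (+-assoc _ _ _))

  ⟦scale⟧ : ∀ s ts x → ⟦ scale s ts ⟧ x ≈ s * ⟦ ts ⟧ x
  ⟦scale⟧ s []             x = sym (zeroʳ s)
  ⟦scale⟧ s ((a , e) ∷ ts) x = trans (+-cong (*-assoc s a _) (⟦scale⟧ s ts x)) (sym (distribˡ s _ _))

  module _ (additive : ∀ k x y → (x + y) ^ (q ℕ.^ k) ≈ x ^ (q ℕ.^ k) + y ^ (q ℕ.^ k)) where

    ⟦frobenius⟧ : ∀ k ts x → ⟦ ts ⟧ x ^ (q ℕ.^ k) ≈ ⟦ frobenius k ts ⟧ x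
    ⟦frobenius⟧ k []             x = 0^q^e≈0 k
    ⟦frobenius⟧ k ((a , e) ∷ ts) x = begin
      (a * x ^ (q ℕ.^ e) + ⟦ ts ⟧ x) ^ (q ℕ.^ k)
        ≈⟨ additive k _ _ ⟩
      (a * x ^ (q ℕ.^ e)) ^ (q ℕ.^ k) + ⟦ ts ⟧ x ^ (q ℕ.^ k)
        ≈⟨ +-cong (^-distrib-* a (x ^ (q ℕ.^ e)) (q ℕ.^ k)) (⟦frobenius⟧ k ts x) ⟩
      a ^ (q ℕ.^ k) * (x ^ (q ℕ.^ e)) ^ (q ℕ.^ k) + ⟦ frobenius k ts ⟧ x
        ≈⟨ +-congʳ (*-congˡ (^-assocʳ x (q ℕ.^ e) (q ℕ.^ k))) ⟩
      a ^ (q ℕ.^ k) * x ^ (q ℕ.^ e ℕ.* q ℕ.^ k) + ⟦ frobenius k ts ⟧ x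
        ≡⟨ ≡.cong (λ E → a ^ (q ℕ.^ k) * x ^ E + ⟦ frobenius k ts ⟧ x) (ℕ.^-distribˡ-+-* q e k) ⟨
      a ^ (q ℕ.^ k) * x ^ (q ℕ.^ (e ℕ.+ k)) + ⟦ frobenius k ts ⟧ x
        ∎

  Degree≤-mono : ∀ {d d′} ts → d ≤ d′ → Degree≤ d ts → Degree≤ d′ ts
  Degree≤-mono ts d≤d′ = All.map (λ e≤d → ℕ.≤-trans e≤d d≤d′)

  Degree≤-scale : ∀ {d} s ts → Degree≤ d ts → Degree≤ d (scale s ts)
  Degree≤-scale s ts = map⁺

  Degree≤-frobenius : ∀ {d} k ts → Degree≤ d ts → Degree≤ (d ℕ.+ k) (frobenius k ts)
  Degree≤-frobenius k ts = map⁺ ∘ All.map (ℕ.+-monoˡ-≤ k)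

  coefficient-++ : ∀ ts us E → coefficient (ts ++ us) E ≈ coefficient ts E + coefficient us E
  coefficient-++ []             us E = sym (+-identityˡ _)
  coefficient-++ ((a , e) ∷ ts) us E = trans (+-congˡ (coefficient-++ ts us E)) (sym (+-assoc _ _ _))

  monomial-* : ∀ e s a k → monomial e (s * a) k ≈ s * monomial e a k
  monomial-* zero    s a zero    = refl
  monomial-* zero    s a (suc k) = sym (zeroʳ s)
  monomial-* (suc e) s a zero    = sym (zeroʳ s)
  monomial-* (suc e) s a (suc k) = monomial-* e s a k

  coefficient-scale : ∀ s ts E → coefficient (scale s ts) E ≈ s * coefficient ts E
  coefficient-scale s []             E = sym (zeroʳ s)
  coefficient-scale s ((a , e) ∷ ts) E =
    trans (+-cong (monomial-* e s a E) (coefficient-scale s ts E)) (sym (distribˡ s _ _))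

  coefficient-absent : ∀ {E} ts → All (λ t → proj₂ t ≢ E) ts → coefficient ts E ≈ 0#
  coefficient-absent []             []            = refl
  coefficient-absent ((a , e) ∷ ts) (e≢E ∷ ts≢E) =
    trans (+-cong (reflexive (monomial-off a e≢E)) (coefficient-absent ts ts≢E)) (+-identityʳ 0#)

  coefficient-unique : ∀ {E ts a us} → All (λ t → proj₂ t ≢ E) ts → All (λ t → proj₂ t ≢ E) us →
                       coefficient (ts ++ (a , E) ∷ us) E ≈ a
  coefficient-unique {E} {ts} {a} {us} ts≢E us≢E = begin
    coefficient (ts ++ (a , E) ∷ us) E
      ≈⟨ coefficient-++ ts _ E ⟩
    coefficient ts E + (monomial E a E + coefficient us E)
      ≈⟨ +-cong (coefficient-absent ts ts≢E) (+-cong (reflexive (monomial-diagonal E a)) (coefficient-absent us us≢E)) ⟩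
    0# + (a + 0#)
      ≈⟨ trans (+-identityˡ _) (+-identityʳ a) ⟩
    a ∎

  coefficient≉0⇒∈ : ∀ {E} ts → ¬ coefficient ts E ≈ 0# → E ∈ map proj₂ ts
  coefficient≉0⇒∈ []             c≉0 = contradiction refl c≉0
  coefficient≉0⇒∈ {E} ((a , e) ∷ ts) c≉0 with e ℕ.≟ E
  ... | yes e≡E = here (≡.sym e≡E)
  ... | no  e≢E = there (coefficient≉0⇒∈ ts λ c≈0 →
                    c≉0 (trans (+-cong (reflexive (monomial-off a e≢E)) c≈0) (+-identityʳ 0#)))

  expanded : Terms → ℕ → Carrier
  expanded []             k = 0#
  expanded ((a , e) ∷ ts) k = monomial (q ℕ.^ e) a k + expanded ts k

  expanded-q^ : ∀ ts E → expanded ts (q ℕ.^ E) ≡ coefficient ts E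
  expanded-q^ []             E = ≡.refl
  expanded-q^ ((a , e) ∷ ts) E = ≡.cong₂ _+_ monomial-q^ (expanded-q^ ts E)
    where
    monomial-q^ : monomial (q ℕ.^ e) a (q ℕ.^ E) ≡ monomial e a E
    monomial-q^ with e ℕ.≟ E
    ... | yes ≡.refl = ≡.trans (monomial-diagonal (q ℕ.^ e) a) (≡.sym (monomial-diagonal e a))
    ... | no  e≢E    = ≡.trans (monomial-off a (e≢E ∘ q^-injective)) (≡.sym (monomial-off a e≢E))

  ⟦⟧≈eval-expanded : ∀ {d n} → d < n → ∀ ts → Degree≤ d ts → ∀ x → ⟦ ts ⟧ x ≈ eval (dense (q ℕ.^ n) (expanded ts)) x
  ⟦⟧≈eval-expanded {n = n} d<n []             []           x = sym (eval-dense-0# (q ℕ.^ n) x)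
  ⟦⟧≈eval-expanded {n = n} d<n ((a , e) ∷ ts) (e≤d ∷ deg) x = begin
    a * x ^ (q ℕ.^ e) + ⟦ ts ⟧ x
      ≈⟨ +-cong (sym (eval-monomial a x (ℕ.^-monoʳ-< q 1<q (ℕ.≤-<-trans e≤d d<n))))
                (⟦⟧≈eval-expanded d<n ts deg x) ⟩
    eval (dense (q ℕ.^ n) (monomial (q ℕ.^ e) a)) x + eval (dense (q ℕ.^ n) (expanded ts)) x
      ≈⟨ eval-dense-+ (q ℕ.^ n) _ _ x ⟨
    eval (dense (q ℕ.^ n) (expanded ((a , e) ∷ ts))) x
      ∎

  -- ⟦ ts ⟧ is a polynomial of degree < q ^ n = |K|, so it vanishes on all of K only if all its coefficients do
  vanishing⇒coefficient≈0 : ∀ {d n} → HasCardinality K (q ℕ.^ n) → d < n → ∀ ts → Degree≤ d ts →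
                            (∀ x → ⟦ ts ⟧ x ≈ 0#) → ∀ E → coefficient ts E ≈ 0#
  vanishing⇒coefficient≈0 {d} {n} card d<n ts deg ts≈0 E with E ℕ.<? n
  ... | yes E<n = trans (reflexive (≡.sym (expanded-q^ ts E)))
                    (dense≈0⇒≈0 (vanishing⇒≈0 _ enum enum-injective expanded≈0) (ℕ.^-monoʳ-< q 1<q E<n))
    where
    open FiniteField K card using (enum; enum-injective)
    expanded≈0 : ∀ i → eval (dense (q ℕ.^ n) (expanded ts)) (enum i) ≈ 0#
    expanded≈0 i = trans (sym (⟦⟧≈eval-expanded d<n ts deg (enum i))) (ts≈0 (enum i))
  ... | no  E≮n = coefficient-absent ts (All.map (λ e≤d e≡E → E≮n (≡.subst (_< n) e≡E (ℕ.≤-<-trans e≤d d<n))) deg)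

  identity⇒coefficient≈ : ∀ {d n} → HasCardinality K (q ℕ.^ n) → d < n → ∀ ts us → Degree≤ d ts → Degree≤ d us →
                          (∀ x → ⟦ ts ⟧ x ≈ ⟦ us ⟧ x) → ∀ E → coefficient ts E ≈ coefficient us E
  identity⇒coefficient≈ card d<n ts us deg-ts deg-us ts≈us E = x∙y⁻¹≈ε⇒x≈y _ _ (begin
    coefficient ts E - coefficient us E            ≈⟨ +-congˡ (-1*x≈-x _) ⟨
    coefficient ts E + - 1# * coefficient us E     ≈⟨ +-congˡ (coefficient-scale (- 1#) us E) ⟨
    coefficient ts E + coefficient (scale (- 1#) us) E ≈⟨ coefficient-++ ts _ E ⟨
    coefficient difference E                       ≈⟨ vanishing⇒coefficient≈0 card d<n difference
                                                        (++⁺ deg-ts (Degree≤-scale (- 1#) us deg-us)) difference≈0 E ⟩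
    0#                                             ∎)
    where
    difference = ts ++ scale (- 1#) us
    difference≈0 : ∀ x → ⟦ difference ⟧ x ≈ 0#
    difference≈0 x = begin
      ⟦ difference ⟧ x                  ≈⟨ ⟦++⟧ ts _ x ⟩
      ⟦ ts ⟧ x + ⟦ scale (- 1#) us ⟧ x  ≈⟨ +-cong (ts≈us x) (trans (⟦scale⟧ (- 1#) us x) (-1*x≈-x _)) ⟩
      ⟦ us ⟧ x - ⟦ us ⟧ x               ≈⟨ -‿inverseʳ _ ⟩
      0#                                ∎

module Indices where

  open import Data.Nat.Base using (suc)
  import Data.Nat.Properties as ℕ
  open import Data.Fin.Base using (Fin; zero; suc; toℕ; fromℕ; inject₁; _↑ˡ_; _↑ʳ_; splitAt; join)
  open import Data.Fin.Properties using (toℕ-fromℕ; toℕ-injective; toℕ-inject₁-≢; inject₁-lower₁; lower₁-inject₁′; join-splitAt)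
  open import Data.Sum using (inj₁; inj₂)
  open import Relation.Binary.PropositionalEquality using (_≡_; refl; sym; trans; cong; subst)
  open import Relation.Nullary using (yes; no; contradiction)

  cpred : ∀ {m} → Fin m → Fin m
  cpred {suc k} zero    = fromℕ k
  cpred {suc k} (suc i) = inject₁ i

  csuc-cpred : ∀ {m} (j : Fin m) → csuc (cpred j) ≡ j
  csuc-cpred {suc k} zero with k ℕ.≟ toℕ (fromℕ k)
  ... | yes _ = refl
  ... | no  k≢k = contradiction (sym (toℕ-fromℕ k)) k≢k
  csuc-cpred {suc k} (suc i) with k ℕ.≟ toℕ (inject₁ i)
  ... | yes k≡i = contradiction k≡i (toℕ-inject₁-≢ i)
  ... | no  k≢i = cong suc (lower₁-inject₁′ i k≢i)

  cpred-csuc : ∀ {m} (i : Fin m) → cpred (csuc i) ≡ i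
  cpred-csuc {suc k} i with k ℕ.≟ toℕ i
  ... | yes k≡i = toℕ-injective (trans (toℕ-fromℕ k) k≡i)
  ... | no  k≢i = inject₁-lower₁ i k≢i

  ↑-cases : ∀ {m n p} {P : Fin (m ℕ.+ n) → Set p} → (∀ i → P (i ↑ˡ n)) → (∀ j → P (m ↑ʳ j)) → ∀ k → P k
  ↑-cases {m} {n} {P = P} P↑ˡ P↑ʳ k = subst P (join-splitAt m n k) (P-join (splitAt m k))
    where
    P-join : ∀ s → P (join m n s)
    P-join (inj₁ i) = P↑ˡ i
    P-join (inj₂ j) = P↑ʳ j

module Graph {c ℓ} (K : Field c ℓ) (q : ℕ.ℕ) {m : ℕ.ℕ} where

  open import Data.Nat.Base using (ℕ)
  open import Data.Fin.Base using (Fin; _↑ˡ_; _↑ʳ_; splitAt)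
  open import Data.Product using (_,_)
  open import Data.Sum using (inj₁; inj₂)
  open import Data.Vec.Functional using (_++_)
  open import Data.Vec.Functional.Properties using (lookup-++ˡ; lookup-++ʳ)
  open import Data.Vec.Functional.Relation.Binary.Pointwise.Properties using (++⁺)
  open import Function using (_∘_)
  open import Relation.Binary.PropositionalEquality as ≡ using (_≡_)

  open Field K hiding (zero)
  open FieldProperties K
  open import Relation.Binary.Reasoning.Setoid setoid

  -- f I J α x i is f_i(x) of the paper, so that U K q m I J α is the graph of f I J α
  f : ℕ → ℕ → (Fin m → Carrier) → (Fin m → Carrier) → Fin m → Carrier
  f I J α x i = x i ^ (q ℕ.^ I) + α (csuc i) * x (csuc i) ^ (q ℕ.^ J)

  f-cong : ∀ I J α {x y} → (∀ k → x k ≈ y k) → ∀ i → f I J α x i ≈ f I J α y i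
  f-cong I J α x≈y i = +-cong (^-congˡ (q ℕ.^ I) (x≈y i)) (*-congˡ (^-congˡ (q ℕ.^ J) (x≈y (csuc i))))

  f≡pow : ∀ I J α x i → f I J α x i ≡ pow K (x i) (q ℕ.^ I) + α (csuc i) * pow K (x (csuc i)) (q ℕ.^ J)
  f≡pow I J α x i = ≡.sym (≡.cong₂ (λ a b → a + α (csuc i) * b) (pow≡^ (x i) (q ℕ.^ I)) (pow≡^ (x (csuc i)) (q ℕ.^ J)))

  graph∈U : ∀ I J α x → U K q m I J α (x ++ f I J α x)
  graph∈U I J α x = x , ++⁺ _≈_ (λ _ → refl) (λ i → reflexive (f≡pow I J α x i))

  U⇒graph : ∀ {I J α w} → U K q m I J α w → ∀ i → w (m ↑ʳ i) ≈ f I J α (λ k → w (k ↑ˡ m)) i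
  U⇒graph {I} {J} {α} {w} (x , w≈x++fx) i = begin
    w (m ↑ʳ i)                                                ≈⟨ w≈x++fx (m ↑ʳ i) ⟩
    (x ++ f′) (m ↑ʳ i)                                        ≡⟨ lookup-++ʳ x f′ i ⟩
    pow K (x i) (q ℕ.^ I) + α (csuc i) * pow K (x (csuc i)) (q ℕ.^ J) ≡⟨ f≡pow I J α x i ⟨
    f I J α x i                                               ≈⟨ f-cong I J α x≈w i ⟩
    f I J α (λ k → w (k ↑ˡ m)) i                              ∎
    where
    f′ = λ i → pow K (x i) (q ℕ.^ I) + α (csuc i) * pow K (x (csuc i)) (q ℕ.^ J)
    x≈w : ∀ k → x k ≈ w (k ↑ˡ m)
    x≈w k = sym (trans (w≈x++fx (k ↑ˡ m)) (reflexive (lookup-++ˡ x f′ k)))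

  module _ (φ : Automorphism K) where

    open Automorphism φ
    open AutomorphismProperties φ

    σ-graph : ∀ I J α x k → σ ((x ++ f I J α x) k) ≈ ((σ ∘ x) ++ f I J (σ ∘ α) (σ ∘ x)) k
    σ-graph I J α x k with splitAt m k
    ... | inj₁ i = refl
    ... | inj₂ i = begin
      σ (x i ^ (q ℕ.^ I) + α (csuc i) * x (csuc i) ^ (q ℕ.^ J))         ≈⟨ σ-+ _ _ ⟩
      σ (x i ^ (q ℕ.^ I)) + σ (α (csuc i) * x (csuc i) ^ (q ℕ.^ J))     ≈⟨ +-cong (σ-^ (x i) (q ℕ.^ I)) (σ-* _ _) ⟩
      σ (x i) ^ (q ℕ.^ I) + σ (α (csuc i)) * σ (x (csuc i) ^ (q ℕ.^ J)) ≈⟨ +-congˡ (*-congˡ (σ-^ (x (csuc i)) (q ℕ.^ J))) ⟩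
      σ (x i) ^ (q ℕ.^ I) + σ (α (csuc i)) * σ (x (csuc i)) ^ (q ℕ.^ J) ∎

module Nonequivalence
  {c ℓ} (K : Field c ℓ) {q n m I J I₀ J₀ : ℕ.ℕ}
  (q-prime-power : IsPrimePower q) (card : HasCardinality K (q ℕ.^ n))
  (J+J₀<n : J ℕ.+ J₀ ℕ.< n) (I<J : I ℕ.< J) (I₀<J₀ : I₀ ℕ.< J₀)
  (α ᾱ : Fin m → Field.Carrier K)
  (α≉0 : ∀ i → ¬ Field._≈_ K (α i) (Field.0# K)) (ᾱ≉0 : ∀ i → ¬ Field._≈_ K (ᾱ i) (Field.0# K))
  (M : Matrix K (m ℕ.+ m)) (φ : Automorphism K) (M-invertible : Invertible K M)
  (image⊆ : ∀ v → U K q m I J α v → U K q m I₀ J₀ ᾱ (_·_ K M (λ k → Automorphism.σ φ (v k))))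
  where

  open import Data.Nat.Base using (ℕ; z≤n)
  import Data.Nat.Properties as ℕ
  open import Data.Fin.Base using (_↑ˡ_; _↑ʳ_)
  open import Data.Fin.Properties using (¬∀⟶∃¬)
  open import Data.List.Base using ([]; _∷_; _++_)
  open import Data.List.Relation.Unary.All using ([]; _∷_)
  open import Data.List.Relation.Unary.All.Properties using (++⁺)
  open import Data.List.Relation.Unary.Any using (here; there)
  open import Data.List.Membership.Propositional using (_∈_)
  open import Data.Product using (Σ; _,_; proj₁; proj₂)
  import Data.Vec.Functional as Vector
  open import Data.Vec.Functional.Properties using (lookup-++ˡ; lookup-++ʳ; updateAt-updates; updateAt-minimal)
  import Data.Vec.Functional.Relation.Binary.Pointwise.Properties as Pointwise
  open import Function using (_∘_)
  open import Relation.Binary.PropositionalEquality as ≡ using (_≡_; _≢_)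
  open import Relation.Nullary using (yes; no)

  open Field K hiding (zero)
  open FieldProperties K
  open import Relation.Binary.Reasoning.Setoid setoid
  open Automorphism φ
  open AutomorphismProperties φ
  open FiniteField K card using (_≟_; ^≈0⇒≈0)
  open Linearized K (Primes.prime-power>1 q-prime-power)
  open Graph K q
  open Indices

  β : Fin m → Carrier
  β = σ ∘ α

  A B D : Fin m → Fin m → Carrier
  A a b = M (a ↑ˡ m) (b ↑ˡ m)
  B a b = M (a ↑ˡ m) (m ↑ʳ b)
  D a b = M (m ↑ʳ a) (m ↑ʳ b)

  w : (Fin m → Carrier) → Fin (m ℕ.+ m) → Carrier
  w z = _·_ K M (z Vector.++ f I J β z)

  w-graph : ∀ z i → w z (m ↑ʳ i) ≈ f I₀ J₀ ᾱ (λ k → w z (k ↑ˡ m)) i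
  w-graph z i = begin
    w z (m ↑ʳ i)                        ≈⟨ Mσv≈w (m ↑ʳ i) ⟨
    Mσv (m ↑ʳ i)                        ≈⟨ U⇒graph {I = I₀} {J = J₀} {α = ᾱ} (image⊆ v (graph∈U I J α x)) i ⟩
    f I₀ J₀ ᾱ (λ k → Mσv (k ↑ˡ m)) i    ≈⟨ f-cong I₀ J₀ ᾱ (λ k → Mσv≈w (k ↑ˡ m)) i ⟩
    f I₀ J₀ ᾱ (λ k → w z (k ↑ˡ m)) i    ∎
    where
    x : Fin m → Carrier
    x k = proj₁ (σ-surjective (z k))
    σx≈z : ∀ k → σ (x k) ≈ z k
    σx≈z k = proj₂ (σ-surjective (z k))
    v = x Vector.++ f I J α x
    Mσv = _·_ K M (σ ∘ v)
    Mσv≈w : ∀ r → Mσv r ≈ w z r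
    Mσv≈w = ·-cong M (λ k → trans (σ-graph φ I J α x k) (Pointwise.++⁺ _≈_ σx≈z (f-cong I J β σx≈z) k))

  single : Fin m → Carrier → Fin m → Carrier
  single j x = Vector.updateAt (λ _ → 0#) j (λ _ → x)

  row : Fin m → Fin (m ℕ.+ m) → Terms
  row j r = (M r (j ↑ˡ m) , 0) ∷ (M r (m ↑ʳ j) , I) ∷ (M r (m ↑ʳ cpred j) * β j , J) ∷ []

  w-expanded : ∀ z r → w z r ≈
    sum (λ i → M r (i ↑ˡ m) * z i) + (sum (λ i → M r (m ↑ʳ i) * z i ^ (q ℕ.^ I)) +
                                      sum (λ i → M r (m ↑ʳ i) * (β (csuc i) * z (csuc i) ^ (q ℕ.^ J))))
  w-expanded z r = begin
    sumK K (λ k → M r k * v k)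
      ≡⟨ sumK≡sum (λ k → M r k * v k) ⟩
    sum (λ k → M r k * v k)
      ≈⟨ sum-↑ m (λ k → M r k * v k) ⟩
    sum (λ i → M r (i ↑ˡ m) * v (i ↑ˡ m)) + sum (λ i → M r (m ↑ʳ i) * v (m ↑ʳ i))
      ≈⟨ +-cong (sum-cong-≋ (λ i → *-congˡ (reflexive (lookup-++ˡ z (f I J β z) i))))
                (trans (sum-cong-≋ (λ i → trans (*-congˡ (reflexive (lookup-++ʳ z (f I J β z) i))) (distribˡ _ _ _)))
                       (∑-distrib-+ {m} _ _)) ⟩
    sum (λ i → M r (i ↑ˡ m) * z i) + (sum (λ i → M r (m ↑ʳ i) * z i ^ (q ℕ.^ I)) +
                                      sum (λ i → M r (m ↑ʳ i) * (β (csuc i) * z (csuc i) ^ (q ℕ.^ J))))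
      ∎
    where v = z Vector.++ f I J β z

  w-single : ∀ j x r → w (single j x) r ≈ ⟦ row j r ⟧ x
  w-single j x r = begin
    w z r
      ≈⟨ w-expanded z r ⟩
    sum (λ i → M r (i ↑ˡ m) * z i) + (sum (λ i → M r (m ↑ʳ i) * z i ^ (q ℕ.^ I)) +
                                      sum (λ i → M r (m ↑ʳ i) * (β (csuc i) * z (csuc i) ^ (q ℕ.^ J))))
      ≈⟨ +-cong (sum-single _ j (λ k k≢j → trans (*-congˡ (z-off k≢j)) (zeroʳ _)))
                (+-cong (sum-single _ j (λ k k≢j → trans (*-congˡ (z^-off I k≢j)) (zeroʳ _)))
                        (sum-single _ (cpred j) (λ k k≢j′ → trans (*-congˡ (βz^-off (k≢j′ ∘ csuc≡j⇒≡cpred))) (zeroʳ _)))) ⟩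
    M r (j ↑ˡ m) * z j + (M r (m ↑ʳ j) * z j ^ (q ℕ.^ I) +
                          M r (m ↑ʳ cpred j) * (β (csuc (cpred j)) * z (csuc (cpred j)) ^ (q ℕ.^ J)))
      ≈⟨ +-cong (*-congˡ z-on) (+-cong (*-congˡ (^-congˡ (q ℕ.^ I) z-on)) (*-congˡ βz^-on)) ⟩
    M r (j ↑ˡ m) * x + (M r (m ↑ʳ j) * x ^ (q ℕ.^ I) + M r (m ↑ʳ cpred j) * (β j * x ^ (q ℕ.^ J)))
      ≈⟨ +-cong (*-congˡ (*-identityʳ x)) (+-congˡ (trans (+-identityʳ _) (*-assoc _ _ _))) ⟨
    ⟦ row j r ⟧ x
      ∎
    where
    z = single j x
    z-on : z j ≈ x
    z-on = reflexive (updateAt-updates j (λ _ → 0#))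
    z-off : ∀ {k} → k ≢ j → z k ≈ 0#
    z-off {k} k≢j = reflexive (updateAt-minimal k j (λ _ → 0#) k≢j)
    z^-off : ∀ e {k} → k ≢ j → z k ^ (q ℕ.^ e) ≈ 0#
    z^-off e k≢j = trans (^-congˡ (q ℕ.^ e) (z-off k≢j)) (0^q^e≈0 e)
    βz^-off : ∀ {k} → csuc k ≢ j → β (csuc k) * z (csuc k) ^ (q ℕ.^ J) ≈ 0#
    βz^-off csuc≢j = trans (*-congˡ (z^-off J csuc≢j)) (zeroʳ _)
    βz^-on : β (csuc (cpred j)) * z (csuc (cpred j)) ^ (q ℕ.^ J) ≈ β j * x ^ (q ℕ.^ J)
    βz^-on = trans (reflexive (≡.cong (λ k → β k * z k ^ (q ℕ.^ J)) (csuc-cpred j))) (*-congˡ (^-congˡ (q ℕ.^ J) z-on))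
    csuc≡j⇒≡cpred : ∀ {k} → csuc k ≡ j → k ≡ cpred j
    csuc≡j⇒≡cpred {k} csuc≡j = ≡.trans (≡.sym (cpred-csuc k)) (≡.cong cpred csuc≡j)

  bottom≈top-powers : ∀ j i x → ⟦ row j (m ↑ʳ i) ⟧ x ≈
    ⟦ row j (i ↑ˡ m) ⟧ x ^ (q ℕ.^ I₀) + ᾱ (csuc i) * ⟦ row j (csuc i ↑ˡ m) ⟧ x ^ (q ℕ.^ J₀)
  bottom≈top-powers j i x = begin
    ⟦ row j (m ↑ʳ i) ⟧ x                         ≈⟨ w-single j x (m ↑ʳ i) ⟨
    w (single j x) (m ↑ʳ i)                      ≈⟨ w-graph (single j x) i ⟩
    f I₀ J₀ ᾱ (λ k → w (single j x) (k ↑ˡ m)) i  ≈⟨ f-cong I₀ J₀ ᾱ (λ k → w-single j x (k ↑ˡ m)) i ⟩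
    f I₀ J₀ ᾱ (λ k → ⟦ row j (k ↑ˡ m) ⟧ x) i     ∎

  row-degree : ∀ j r → Degree≤ J (row j r)
  row-degree j r = z≤n ∷ ℕ.<⇒≤ I<J ∷ ℕ.≤-refl ∷ []

  bottom-coefficients : ∀ j i ts us → Degree≤ J ts → Degree≤ J us →
    (∀ x → ⟦ row j (i ↑ˡ m) ⟧ x ≈ ⟦ ts ⟧ x) → (∀ x → ⟦ row j (csuc i ↑ˡ m) ⟧ x ≈ ⟦ us ⟧ x) →
    ∀ E → coefficient (row j (m ↑ʳ i)) E ≈ coefficient (frobenius I₀ ts ++ scale (ᾱ (csuc i)) (frobenius J₀ us)) E
  bottom-coefficients j i ts us ts-degree us-degree top≈ts top′≈us =
    identity⇒coefficient≈ card J+J₀<n (row j (m ↑ʳ i)) (frobenius I₀ ts ++ scale (ᾱ (csuc i)) (frobenius J₀ us))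
      (Degree≤-mono _ (ℕ.m≤m+n J J₀) (row-degree j (m ↑ʳ i)))
      (++⁺ (Degree≤-mono _ (ℕ.+-monoʳ-≤ J (ℕ.<⇒≤ I₀<J₀)) (Degree≤-frobenius I₀ ts ts-degree))
           (Degree≤-scale _ _ (Degree≤-frobenius J₀ us us-degree)))
      λ x → begin
        ⟦ row j (m ↑ʳ i) ⟧ x
          ≈⟨ bottom≈top-powers j i x ⟩
        ⟦ row j (i ↑ˡ m) ⟧ x ^ (q ℕ.^ I₀) + ᾱ (csuc i) * ⟦ row j (csuc i ↑ˡ m) ⟧ x ^ (q ℕ.^ J₀)
          ≈⟨ +-cong (^-congˡ (q ℕ.^ I₀) (top≈ts x)) (*-congˡ (^-congˡ (q ℕ.^ J₀) (top′≈us x))) ⟩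
        ⟦ ts ⟧ x ^ (q ℕ.^ I₀) + ᾱ (csuc i) * ⟦ us ⟧ x ^ (q ℕ.^ J₀)
          ≈⟨ +-cong (⟦frobenius⟧ additive I₀ ts x)
                    (trans (*-congˡ (⟦frobenius⟧ additive J₀ us x)) (sym (⟦scale⟧ (ᾱ (csuc i)) (frobenius J₀ us) x))) ⟩
        ⟦ frobenius I₀ ts ⟧ x + ⟦ scale (ᾱ (csuc i)) (frobenius J₀ us) ⟧ x
          ≈⟨ ⟦++⟧ (frobenius I₀ ts) (scale (ᾱ (csuc i)) (frobenius J₀ us)) x ⟨
        ⟦ frobenius I₀ ts ++ scale (ᾱ (csuc i)) (frobenius J₀ us) ⟧ x
          ∎
    where additive = Frobenius.prime-power-additive K {n = n} q-prime-power card

  -- Exponent q^(J+J₀) exceeds every exponent on the left, and on the right it only arises from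
  -- the J-term of the first half, raised to the power q^J₀.
  upper-right≈0 : ∀ a b → B a b ≈ 0#
  upper-right≈0 a b = ≡.subst₂ (λ a b → B a b ≈ 0#) (csuc-cpred a) (cpred-csuc b) (B≈0 (cpred a) (csuc b))
    where
    top-coefficient≈0 : ∀ i j → ᾱ (csuc i) * (B (csuc i) (cpred j) * β j) ^ (q ℕ.^ J₀) ≈ 0#
    top-coefficient≈0 i j = begin
      ᾱ (csuc i) * (B (csuc i) (cpred j) * β j) ^ (q ℕ.^ J₀)
        ≈⟨ coefficient-unique (ℕ.<⇒≢ (ℕ.<-≤-trans I₀<J₀ (ℕ.m≤n+m J₀ J)) ∷ ℕ.<⇒≢ (ℕ.+-mono-< I<J I₀<J₀) ∷
                               ℕ.<⇒≢ (ℕ.+-monoʳ-< J I₀<J₀) ∷ ℕ.<⇒≢ (ℕ.m<n+m J₀ 0<J) ∷ ℕ.<⇒≢ (ℕ.+-monoˡ-< J₀ I<J) ∷ []) [] ⟨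
      coefficient (frobenius I₀ (row j (i ↑ˡ m)) ++ scale (ᾱ (csuc i)) (frobenius J₀ (row j (csuc i ↑ˡ m)))) (J ℕ.+ J₀)
        ≈⟨ bottom-coefficients j i _ _ (row-degree j _) (row-degree j _) (λ _ → refl) (λ _ → refl) (J ℕ.+ J₀) ⟨
      coefficient (row j (m ↑ʳ i)) (J ℕ.+ J₀)
        ≈⟨ coefficient-absent (row j (m ↑ʳ i)) (ℕ.<⇒≢ (ℕ.<-≤-trans 0<J (ℕ.m≤m+n J J₀)) ∷
                                                 ℕ.<⇒≢ (ℕ.<-≤-trans I<J (ℕ.m≤m+n J J₀)) ∷ ℕ.<⇒≢ (ℕ.m<m+n J 0<J₀) ∷ []) ⟩
      0# ∎
      where
      0<J = ℕ.≤-<-trans z≤n I<J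
      0<J₀ = ℕ.≤-<-trans z≤n I₀<J₀
    B≈0 : ∀ i j → B (csuc i) (cpred j) ≈ 0#
    B≈0 i j = x*y≈0⇒y≈0 (σ-≉0 (α≉0 j)) (trans (*-comm _ _)
                (^≈0⇒≈0 (q ℕ.^ J₀) (x*y≈0⇒y≈0 (ᾱ≉0 (csuc i)) (top-coefficient≈0 i j))))

  top-row≈diagonal : ∀ j i x → ⟦ row j (i ↑ˡ m) ⟧ x ≈ ⟦ (A i j , 0) ∷ [] ⟧ x
  top-row≈diagonal j i x = +-congˡ (begin
    B i j * x ^ (q ℕ.^ I) + (B i (cpred j) * β j * x ^ (q ℕ.^ J) + 0#)
      ≈⟨ +-cong (B*≈0 (upper-right≈0 i j)) (+-congʳ (B*≈0 (B*≈0 (upper-right≈0 i (cpred j))))) ⟩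
    0# + (0# + 0#)
      ≈⟨ trans (+-identityˡ _) (+-identityˡ 0#) ⟩
    0# ∎)
    where
    B*≈0 : ∀ {b y} → b ≈ 0# → b * y ≈ 0#
    B*≈0 {y = y} b≈0 = trans (*-congʳ b≈0) (zeroˡ y)

  diagonal-powers : Fin m → Fin m → Terms
  diagonal-powers j i = (A i j ^ (q ℕ.^ I₀) , I₀) ∷ (ᾱ (csuc i) * A (csuc i) j ^ (q ℕ.^ J₀) , J₀) ∷ []

  bottom-coefficients-diagonal : ∀ j i E → coefficient (row j (m ↑ʳ i)) E ≈ coefficient (diagonal-powers j i) E
  bottom-coefficients-diagonal j i =
    bottom-coefficients j i _ _ (z≤n ∷ []) (z≤n ∷ []) (top-row≈diagonal j i) (top-row≈diagonal j (csuc i))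

  -- Once B = 0 both sides of the bottom identity are short: nonzero entries of D and A force
  -- their exponents on one side to occur on the other.
  D≉0⇒I∈ : ∀ a b → ¬ D a b ≈ 0# → I ∈ 0 ∷ I₀ ∷ J₀ ∷ []
  D≉0⇒I∈ a b D≉0 with I ℕ.≟ 0
  ... | yes I≡0 = here I≡0
  ... | no  I≢0 = there (coefficient≉0⇒∈ (diagonal-powers b a) λ c≈0 → D≉0 (begin
    D a b                                      ≈⟨ coefficient-unique (I≢0 ∘ ≡.sym ∷ []) (ℕ.>⇒≢ I<J ∷ []) ⟨
    coefficient (row b (m ↑ʳ a)) I             ≈⟨ bottom-coefficients-diagonal b a I ⟩
    coefficient (diagonal-powers b a) I        ≈⟨ c≈0 ⟩
    0#                                         ∎))

  D≉0⇒J∈ : ∀ a j → ¬ D a (cpred j) ≈ 0# → J ∈ 0 ∷ I₀ ∷ J₀ ∷ []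
  D≉0⇒J∈ a j D≉0 = there (coefficient≉0⇒∈ (diagonal-powers j a) λ c≈0 →
    D≉0 (x*y≈0⇒y≈0 (σ-≉0 (α≉0 j)) (trans (*-comm _ _) (begin
      D a (cpred j) * β j                      ≈⟨ coefficient-unique (ℕ.<⇒≢ (ℕ.≤-<-trans z≤n I<J) ∷ ℕ.<⇒≢ I<J ∷ []) [] ⟨
      coefficient (row j (m ↑ʳ a)) J           ≈⟨ bottom-coefficients-diagonal j a J ⟩
      coefficient (diagonal-powers j a) J      ≈⟨ c≈0 ⟩
      0#                                       ∎))))

  A≉0⇒I₀∈ : ∀ a b → ¬ A a b ≈ 0# → I₀ ∈ 0 ∷ I ∷ J ∷ []
  A≉0⇒I₀∈ a b A≉0 = coefficient≉0⇒∈ (row b (m ↑ʳ a)) λ c≈0 → A≉0 (^≈0⇒≈0 (q ℕ.^ I₀) (begin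
    A a b ^ (q ℕ.^ I₀)                         ≈⟨ coefficient-unique [] (ℕ.>⇒≢ I₀<J₀ ∷ []) ⟨
    coefficient (diagonal-powers b a) I₀       ≈⟨ bottom-coefficients-diagonal b a I₀ ⟨
    coefficient (row b (m ↑ʳ a)) I₀            ≈⟨ c≈0 ⟩
    0#                                         ∎))

  A≉0⇒J₀∈ : ∀ i b → ¬ A (csuc i) b ≈ 0# → J₀ ∈ 0 ∷ I ∷ J ∷ []
  A≉0⇒J₀∈ i b A≉0 = coefficient≉0⇒∈ (row b (m ↑ʳ i)) λ c≈0 → A≉0 (^≈0⇒≈0 (q ℕ.^ J₀) (x*y≈0⇒y≈0 (ᾱ≉0 (csuc i)) (begin
    ᾱ (csuc i) * A (csuc i) b ^ (q ℕ.^ J₀)     ≈⟨ coefficient-unique (ℕ.<⇒≢ I₀<J₀ ∷ []) [] ⟨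
    coefficient (diagonal-powers b i) J₀       ≈⟨ bottom-coefficients-diagonal b i J₀ ⟨
    coefficient (row b (m ↑ʳ i)) J₀            ≈⟨ c≈0 ⟩
    0#                                         ∎)))

  lower-right≉0 : ∀ b → Σ (Fin m) λ a → ¬ D a b ≈ 0#
  lower-right≉0 b = ¬∀⟶∃¬ m (λ a → D a b ≈ 0#) (λ a → D a b ≟ 0#) λ D≈0 →
    invertible⇒column≉0 M-invertible (m ↑ʳ b) (↑-cases (λ a → upper-right≈0 a b) D≈0)

  upper-left≉0 : ∀ a → Σ (Fin m) λ b → ¬ A a b ≈ 0#
  upper-left≉0 a = ¬∀⟶∃¬ m (λ b → A a b ≈ 0#) (λ b → A a b ≟ 0#) λ A≈0 →
    invertible⇒row≉0 M-invertible (a ↑ˡ m) (↑-cases A≈0 (upper-right≈0 a))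

  exponents-equal : Fin m → (I , J) ≡ (I₀ , J₀)
  exponents-equal b₀ with lower-right≉0 b₀ | upper-left≉0 b₀
  ... | a , D≉0 | b , A≉0 = IncreasingPairs.0∷I∷J-injective I<J I₀<J₀
    (D≉0⇒I∈ a b₀ D≉0) (D≉0⇒J∈ a (csuc b₀) (≡.subst (λ b → ¬ D a b ≈ 0#) (≡.sym (cpred-csuc b₀)) D≉0))
    (A≉0⇒I₀∈ b₀ b A≉0) (A≉0⇒J₀∈ (cpred b₀) b (≡.subst (λ a → ¬ A a b ≈ 0#) (≡.sym (csuc-cpred b₀)) A≉0))

open import Data.Nat using (ℕ; _+_; _^_; _≤_; _<_; s≤s)
open import Data.Product using (_,_)

mainTheorem11 : ∀ {c ℓ : Level} (q n m I J I₀ J₀ : ℕ) →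
    IsPrimePower q → 1 ≤ n → 3 ≤ m →
    (K : Field c ℓ) → HasCardinality K (q ^ n) →
    J + J₀ < n → I < J → I₀ < J₀ →
    (α ᾱ : Fin m → Field.Carrier K) →
    (∀ i → ¬ (Field._≈_ K (α i) (Field.0# K))) →
    (∀ i → ¬ (Field._≈_ K (ᾱ i) (Field.0# K))) →
    ¬ ((I , J) ≡ (I₀ , J₀)) →
    ¬ ΓL-Equivalent K (U K q m I J α) (U K q m I₀ J₀ ᾱ)
mainTheorem11 q n m I J I₀ J₀ q-prime-power _ (s≤s _) K card J+J₀<n I<J I₀<J₀ α ᾱ α≉0 ᾱ≉0 IJ≢I₀J₀
              (M , φ , M-invertible , image⊆ , _) =
  IJ≢I₀J₀ (Nonequivalence.exponents-equal K q-prime-power card J+J₀<n I<J I₀<J₀ α ᾱ α≉0 ᾱ≉0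
                                          M φ M-invertible image⊆ Data.Fin.zero)
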